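{- Let $p$ and $q$ be nonzero integers with $p - q \neq 1$. Let $(V_n)_{n\ge0}$ be defined by $V_0=2$, $V_1=p$, and $V_n = pV_{n-1}-qV_{n-2}$ for $n\ge2$. Then for all $n \geq 1$, $$\sum_{i=1}^n i\, V_i = \frac{1}{p-q-1} \left( n (V_{n+1} - q V_n) + 2 q - \frac{\Psi(n)}{p-q-1} \right),$$ where $\Psi(n) = V_{n+1} - 2q V_n + q^2 V_{n-1} +(p-2q)(q-1)$.
   Context: $(V_n)$ is the Lucas sequence of the second kind with parameters $p,q$. -}

module Defs where

open import Data.Nat using (ℕ; zero; suc)
open import Data.Integer using (ℤ; +_; _+_; _-_; _*_)

V : ℤ → ℤ → ℕ → ℤ
V p q zero = + 2
V p q (suc zero) = p
V p q (suc (suc n)) = p * V p q (suc n) - q * V p q n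

sumiV : ℤ → ℤ → ℕ → ℤ
sumiV p q zero = + 0
sumiV p q (suc n) = sumiV p q n + (+ suc n) * V p q (suc n)

-- Ψ(n) for n ≥ 1, written with m = n - 1 (so n = suc m)
Ψ : ℤ → ℤ → ℕ → ℤ
Ψ p q m = V p q (suc (suc m)) - (+ 2) * q * V p q (suc m) + q * q * V p q m
          + (p - (+ 2) * q) * (q - + 1)

-- Once both denominators are cleared the claim is a polynomial identity in p, q and the
-- terms of V, true for all integers p and q; the hypotheses p ≠ 0, q ≠ 0 and p - q ≠ 1
-- only make the paper's quotient form meaningful. It follows by induction on n: by the
-- recurrence, the cleared right-hand side grows from n to n + 1 by exactly
-- (p - q - 1)² (n + 1) V_{n+1}, the increment of the cleared left-hand side.
module Submission where

open import Defs
open import Data.Nat using (ℕ; suc; zero)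
open import Data.Integer using (ℤ; +_; _+_; _-_; _*_)
open import Data.Integer.Properties using (*-distribˡ-+)
open import Data.Integer.Tactic.RingSolver using (solve-∀)
open import Relation.Binary.PropositionalEquality using (_≡_; _≢_; cong; module ≡-Reasoning)

sumiV-closedForm : ℤ → ℤ → ℕ → ℤ
sumiV-closedForm p q m =
  (p - q - + 1) * ((+ suc m) * (V p q (suc (suc m)) - q * V p q (suc m)) + (+ 2) * q) - Ψ p q m

-- The two identities below are the cases of sumiV-closedForm with V unfolded: in the second,
-- a and b stand for V_m and V_{m+1}, and k for m + 1.
private
  closedForm-base-identity : (p q : ℤ) →
    (p - q - + 1) * (p - q - + 1) * (+ 0 + + 1 * p)
      ≡ (p - q - + 1) * (+ 1 * ((p * p - q * + 2) - q * p) + (+ 2) * q)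
        - ((p * p - q * + 2) - (+ 2) * q * p + q * q * + 2 + (p - (+ 2) * q) * (q - + 1))
  closedForm-base-identity = solve-∀

  closedForm-increment-identity : (p q a b k : ℤ) →
    ((p - q - + 1) * (k * ((p * b - q * a) - q * b) + (+ 2) * q)
      - ((p * b - q * a) - (+ 2) * q * b + q * q * a + (p - (+ 2) * q) * (q - + 1)))
    + (p - q - + 1) * (p - q - + 1) * ((+ 1 + k) * (p * b - q * a))
      ≡ (p - q - + 1) * ((+ 1 + k) * ((p * (p * b - q * a) - q * b) - q * (p * b - q * a)) + (+ 2) * q)
        - ((p * (p * b - q * a) - q * b) - (+ 2) * q * (p * b - q * a) + q * q * b
          + (p - (+ 2) * q) * (q - + 1))
  closedForm-increment-identity = solve-∀

sumiV-closedForm-zero : (p q : ℤ) →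
  (p - q - + 1) * (p - q - + 1) * sumiV p q 1 ≡ sumiV-closedForm p q zero
sumiV-closedForm-zero = closedForm-base-identity

sumiV-closedForm-suc : (p q : ℤ) (m : ℕ) →
  sumiV-closedForm p q m + (p - q - + 1) * (p - q - + 1) * ((+ suc (suc m)) * V p q (suc (suc m)))
    ≡ sumiV-closedForm p q (suc m)
sumiV-closedForm-suc p q m = closedForm-increment-identity p q (V p q m) (V p q (suc m)) (+ suc m)

scaled-sumiV≡closedForm : (p q : ℤ) (m : ℕ) →
  (p - q - + 1) * (p - q - + 1) * sumiV p q (suc m) ≡ sumiV-closedForm p q m
scaled-sumiV≡closedForm p q zero = sumiV-closedForm-zero p q
scaled-sumiV≡closedForm p q (suc m) = begin
  d² * (sumiV p q (suc m) + increment)             ≡⟨ *-distribˡ-+ d² (sumiV p q (suc m)) increment ⟩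
  d² * sumiV p q (suc m) + d² * increment          ≡⟨ cong (_+ d² * increment) (scaled-sumiV≡closedForm p q m) ⟩
  sumiV-closedForm p q m + d² * increment          ≡⟨ sumiV-closedForm-suc p q m ⟩
  sumiV-closedForm p q (suc m)                     ∎
  where
  open ≡-Reasoning
  d² increment : ℤ
  d² = (p - q - + 1) * (p - q - + 1)
  increment = (+ suc (suc m)) * V p q (suc (suc m))

theorem4p8 : (p q : ℤ) → p ≢ + 0 → q ≢ + 0 → p - q ≢ + 1 →
    (m : ℕ) →
      (p - q - + 1) * (p - q - + 1) * sumiV p q (suc m)
        ≡ (p - q - + 1) * ((+ suc m) * (V p q (suc (suc m)) - q * V p q (suc m)) + (+ 2) * q)
          - Ψ p q m
theorem4p8 p q _ _ _ = scaled-sumiV≡closedForm p q
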